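{- Let $L$ be an irreflexive linear order on a finite set $Z$, and let $P\subseteq L$ be a partial order. Then $P=L\cap L'$ for some irreflexive linear order $L'$ on $Z$ if and only if $L\setminus P$ is a partial order.
   Context: Binary relations on $Z$ are sets of ordered pairs. A partial order here is an irreflexive transitive relation; an irreflexive linear order is a partial order $L$ such that for any distinct $x,y\in Z$, exactly one of $(x,y),(y,x)$ lies in $L$. -}

module Defs where

open import Data.Nat using (ℕ)
open import Data.Fin using (Fin)
open import Data.Bool using (Bool; true; false; _∧_; not)
open import Data.Empty using (⊥)
open import Relation.Binary.PropositionalEquality using (_≡_; _≢_)
open import Data.Sum using (_⊎_)
open import Data.Product using (_×_)

-- A binary relation on the finite set Z = Fin n, given by its (decidable)
-- characteristic function: (x , y) ∈ R  iff  R x y ≡ true.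
BRel : ℕ → Set
BRel n = Fin n → Fin n → Bool

module _ {n : ℕ} where

  _∈R_ : Fin n → Fin n → BRel n → Set
  _∈R_ = λ x y R → R x y ≡ true

  Irreflexive : BRel n → Set
  Irreflexive R = ∀ x → R x x ≡ false

  Transitive : BRel n → Set
  Transitive R = ∀ x y z → R x y ≡ true → R y z ≡ true → R x z ≡ true

  IsPartialOrder : BRel n → Set
  IsPartialOrder R = Irreflexive R × Transitive R

  ExactlyOne : Bool → Bool → Set
  ExactlyOne a b = (a ≡ true × b ≡ false) ⊎ (a ≡ false × b ≡ true)

  IsLinearOrder : BRel n → Set
  IsLinearOrder R = IsPartialOrder R × (∀ x y → x ≢ y → ExactlyOne (R x y) (R y x))

  _∩R_ : BRel n → BRel n → BRel n
  (R ∩R S) x y = R x y ∧ S x y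

  _∖R_ : BRel n → BRel n → BRel n
  (R ∖R S) x y = R x y ∧ not (S x y)

  _⊆R_ : BRel n → BRel n → Set
  R ⊆R S = ∀ x y → R x y ≡ true → S x y ≡ true

  _≐R_ : BRel n → BRel n → Set
  R ≐R S = ∀ x y → R x y ≡ S x y

-- If P = L ∩ L′ for a linear order L′, then L ∖ P = L ∩ L′ᵒᵖ is an
-- intersection of partial orders.  Conversely, if Q = L ∖ P is a partial
-- order, reversing L outside P gives L′ = P ∪ Qᵒᵖ, which meets L exactly in P.
-- L′ is irreflexive and, like L, total, so only transitivity needs an
-- argument: a P-step followed by a reversed Q-step is settled by comparing
-- its endpoints in L and using transitivity of P and of Q; the opposite mixed
-- case is the same argument applied to the converse orders.
module Submission where

open import Defs
open import Data.Nat using (ℕ)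
open import Data.Bool using (true; false; _∧_; _∨_; not)
open import Data.Bool.Properties using (not-injective)
open import Data.Empty using (⊥; ⊥-elim)
open import Data.Fin using (_≟_)
open import Data.Product using (Σ; _×_; _,_; proj₁; proj₂)
open import Data.Sum using (_⊎_; inj₁; inj₂; [_,_]′; swap)
open import Function.Base using (flip; _∘_)
open import Function.Bundles using (_⇔_; mk⇔)
open import Relation.Binary.PropositionalEquality using (_≡_; _≢_; refl; sym; subst; cong; module ≡-Reasoning)
open import Relation.Nullary using (yes; no)

∧-true⁻ : ∀ {a b} → a ∧ b ≡ true → a ≡ true × b ≡ true
∧-true⁻ {true} b≡true = refl , b≡true

∨-true⁻ : ∀ {a b} → a ∨ b ≡ true → a ≡ true ⊎ b ≡ true
∨-true⁻ {true}  _      = inj₁ refl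
∨-true⁻ {false} b≡true = inj₂ b≡true

∨-true⁺ : ∀ {a b} → a ≡ true ⊎ b ≡ true → a ∨ b ≡ true
∨-true⁺ (inj₁ refl)             = refl
∨-true⁺ {true}  (inj₂ _)      = refl
∨-true⁺ {false} (inj₂ b≡true) = b≡true

true-and-false : ∀ {a} → a ≡ true → a ≡ false → ⊥
true-and-false refl ()

exactlyOne⇒≡not : ∀ {n a b} → ExactlyOne {n} a b → b ≡ not a
exactlyOne⇒≡not (inj₁ (refl , refl)) = refl
exactlyOne⇒≡not (inj₂ (refl , refl)) = refl

module _ {n : ℕ} where

  private variable
    R S L L′ P : BRel n

  _∪R_ : BRel n → BRel n → BRel n
  (R ∪R S) x y = R x y ∨ S x y

  Total : BRel n → Set
  Total R = ∀ x y → x ≢ y → R x y ≡ true ⊎ R y x ≡ true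

  flip-transitive : Transitive R → Transitive (flip R)
  flip-transitive trans x y z Ryx Rzy = trans z y x Rzy Ryx

  flip-isPartialOrder : IsPartialOrder R → IsPartialOrder (flip R)
  flip-isPartialOrder (irr , trans) = irr , flip-transitive trans

  ∩-isPartialOrder : IsPartialOrder R → IsPartialOrder S → IsPartialOrder (R ∩R S)
  ∩-isPartialOrder {R} {S} (irrR , transR) (irrS , transS) = irr , trans
    where
    irr : Irreflexive (R ∩R S)
    irr x rewrite irrR x = refl

    trans : Transitive (R ∩R S)
    trans x y z xy yz with ∧-true⁻ xy | ∧-true⁻ yz
    ... | Rxy , Sxy | Ryz , Syz rewrite transR x y z Rxy Ryz = transS x y z Sxy Syz

  ≐-isPartialOrder : R ≐R S → IsPartialOrder R → IsPartialOrder S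
  ≐-isPartialOrder {R} {S} R≐S (irr , trans) = irr′ , trans′
    where
    irr′ : Irreflexive S
    irr′ x = subst (_≡ false) (R≐S x x) (irr x)

    trans′ : Transitive S
    trans′ x y z Sxy Syz = subst (_≡ true) (R≐S x z)
      (trans x y z (subst (_≡ true) (sym (R≐S x y)) Sxy) (subst (_≡ true) (sym (R≐S y z)) Syz))

  partialOrder-asym : IsPartialOrder R → ∀ {x y} → R x y ≡ true → R y x ≡ false
  partialOrder-asym {R} (irr , trans) {x} {y} Rxy with R y x in Ryx
  ... | false = refl
  ... | true  = ⊥-elim (true-and-false (trans x y x Rxy Ryx) (irr x))

  total⇒isLinearOrder : IsPartialOrder R → Total R → IsLinearOrder R
  total⇒isLinearOrder {R} po total = po , exactlyOne
    where
    exactlyOne : ∀ x y → x ≢ y → ExactlyOne {n} (R x y) (R y x)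
    exactlyOne x y x≢y with total x y x≢y
    ... | inj₁ Rxy = inj₁ (Rxy , partialOrder-asym po Rxy)
    ... | inj₂ Ryx = inj₂ (partialOrder-asym po Ryx , Ryx)

  module _ {L : BRel n} (L-linear : IsLinearOrder L) where

    linear-irreflexive : Irreflexive L
    linear-irreflexive = proj₁ (proj₁ L-linear)

    linear-≢ : ∀ {x y} → L x y ≡ true → x ≢ y
    linear-≢ {x} Lxx refl = true-and-false Lxx (linear-irreflexive x)

    linear-asym : ∀ {x y} → L x y ≡ true → L y x ≡ false
    linear-asym = partialOrder-asym (proj₁ L-linear)

    linear-total : Total L
    linear-total x y x≢y with proj₂ L-linear x y x≢y
    ... | inj₁ (Lxy , _) = inj₁ Lxy
    ... | inj₂ (_ , Lyx) = inj₂ Lyx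

    linear-flip≡not : ∀ {x y} → x ≢ y → L y x ≡ not (L x y)
    linear-flip≡not {x} {y} x≢y = exactlyOne⇒≡not {n} (proj₂ L-linear x y x≢y)

    flip-isLinearOrder : IsLinearOrder (flip L)
    flip-isLinearOrder = total⇒isLinearOrder (flip-isPartialOrder (proj₁ L-linear))
      λ x y x≢y → swap (linear-total x y x≢y)

  ∩flip≐∖ : IsLinearOrder L → IsLinearOrder L′ → P ≐R (L ∩R L′) → (L ∩R flip L′) ≐R (L ∖R P)
  ∩flip≐∖ {L} {L′} {P} L-linear L′-linear P≐L∩L′ x y with L x y in Lxy
  ... | false = refl
  ... | true  = begin
    L′ y x                ≡⟨ linear-flip≡not L′-linear (linear-≢ L-linear Lxy) ⟩
    not (L′ x y)          ≡⟨ cong (λ b → not (b ∧ L′ x y)) Lxy ⟨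
    not (L x y ∧ L′ x y)  ≡⟨ cong not (P≐L∩L′ x y) ⟨
    not (P x y)           ∎
    where open ≡-Reasoning

  flipOutside : BRel n → BRel n → BRel n
  flipOutside L P = P ∪R flip (L ∖R P)

  module _ {L P : BRel n} where

    ∖-split : ∀ {x y} → L x y ≡ true → P x y ≡ true ⊎ (L ∖R P) x y ≡ true
    ∖-split {x} {y} Lxy with P x y
    ... | true  = inj₁ refl
    ... | false rewrite Lxy = inj₂ refl

    ∖-disjoint : ∀ {x y} → P x y ≡ true → (L ∖R P) x y ≡ true → ⊥
    ∖-disjoint Pxy L∖Pxy = true-and-false Pxy (not-injective (proj₂ (∧-true⁻ L∖Pxy)))

    flipOutside-mixed : IsLinearOrder L → Transitive P → Transitive (L ∖R P) →
                        ∀ {x y z} → P x y ≡ true → (L ∖R P) z y ≡ true → flipOutside L P x z ≡ true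
    flipOutside-mixed L-linear P-trans Q-trans {x} {y} {z} Pxy Qzy with x ≟ z
    ... | yes refl = ⊥-elim (∖-disjoint Pxy Qzy)
    ... | no x≢z with linear-total L-linear x z x≢z
    ...   | inj₁ Lxz = ∨-true⁺ ([ inj₁ , (λ Qxz → ⊥-elim (∖-disjoint Pxy (Q-trans x z y Qxz Qzy))) ]′
                                (∖-split Lxz))
    ...   | inj₂ Lzx = ∨-true⁺ ([ (λ Pzx → ⊥-elim (∖-disjoint (P-trans z x y Pzx Pxy) Qzy)) , inj₂ ]′
                                (∖-split Lzx))

    flipOutside-irreflexive : Irreflexive L → Irreflexive P → Irreflexive (flipOutside L P)
    flipOutside-irreflexive L-irr P-irr x rewrite P-irr x | L-irr x = refl

    flipOutside-total : IsLinearOrder L → Total (flipOutside L P)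
    flipOutside-total L-linear x y x≢y = [ connects , swap ∘ connects ]′ (linear-total L-linear x y x≢y)
      where
      connects : ∀ {a b} → L a b ≡ true → flipOutside L P a b ≡ true ⊎ flipOutside L P b a ≡ true
      connects Lab = [ inj₁ ∘ ∨-true⁺ ∘ inj₁ , inj₂ ∘ ∨-true⁺ ∘ inj₂ ]′ (∖-split Lab)

    ≐∩flipOutside : IsLinearOrder L → P ⊆R L → P ≐R (L ∩R flipOutside L P)
    ≐∩flipOutside L-linear P⊆L x y with P x y in Pxy
    ... | true rewrite P⊆L x y Pxy = refl
    ... | false with L x y in Lxy
    ...   | false = refl
    ...   | true rewrite linear-asym L-linear Lxy = refl

  flipOutside-transitive : IsLinearOrder L → Transitive P → Transitive (L ∖R P) → Transitive (flipOutside L P)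
  flipOutside-transitive L-linear P-trans Q-trans x y z L′xy L′yz with ∨-true⁻ L′xy | ∨-true⁻ L′yz
  ... | inj₁ Pxy | inj₁ Pyz = ∨-true⁺ (inj₁ (P-trans x y z Pxy Pyz))
  ... | inj₁ Pxy | inj₂ Qzy = flipOutside-mixed L-linear P-trans Q-trans Pxy Qzy
  ... | inj₂ Qyx | inj₁ Pyz =
    flipOutside-mixed (flip-isLinearOrder L-linear) (flip-transitive P-trans) (flip-transitive Q-trans) Pyz Qyx
  ... | inj₂ Qyx | inj₂ Qzy = ∨-true⁺ (inj₂ (Q-trans z y x Qzy Qyx))

  flipOutside-isLinearOrder : IsLinearOrder L → IsPartialOrder P → Transitive (L ∖R P) →
                              IsLinearOrder (flipOutside L P)
  flipOutside-isLinearOrder {L} {P} L-linear (P-irr , P-trans) Q-trans = total⇒isLinearOrder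
    (flipOutside-irreflexive {L} {P} (linear-irreflexive L-linear) P-irr , flipOutside-transitive L-linear P-trans Q-trans)
    (flipOutside-total L-linear)

mainTheorem18 : (n : ℕ) (L P : BRel n) → IsLinearOrder L → IsPartialOrder P → P ⊆R L
    → ((Σ (BRel n) λ L′ → IsLinearOrder L′ × (P ≐R (L ∩R L′))) ⇔ IsPartialOrder (L ∖R P))
mainTheorem18 n L P L-linear P-po P⊆L = mk⇔ intersection⇒difference difference⇒intersection
  where
  intersection⇒difference : Σ (BRel n) (λ L′ → IsLinearOrder L′ × (P ≐R (L ∩R L′))) → IsPartialOrder (L ∖R P)
  intersection⇒difference (L′ , L′-linear , P≐L∩L′) =
    ≐-isPartialOrder (∩flip≐∖ L-linear L′-linear P≐L∩L′)
      (∩-isPartialOrder (proj₁ L-linear) (flip-isPartialOrder (proj₁ L′-linear)))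

  difference⇒intersection : IsPartialOrder (L ∖R P) → Σ (BRel n) (λ L′ → IsLinearOrder L′ × (P ≐R (L ∩R L′)))
  difference⇒intersection (_ , Q-trans) =
    flipOutside L P , flipOutside-isLinearOrder L-linear P-po Q-trans , ≐∩flipOutside L-linear P⊆L
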